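{- Let $M=(E,\rho)$ be a matroid and $X\subset Y\subseteq E$ two sets such that $Y$ is a dependent set of full rank ($\rho(Y)=\rho(E)$) and $X$ is an independent set with $\rho(X)<\rho(E)$. Let $k=\rho(E)-\rho(X)$ and $n=|Y-X|$. Then the minor $M|Y/X$ is isomorphic to the uniform matroid $U_n^k$ if and only if (1) $\mathrm{cl}(X)\cap Y=X$, (2) $Y-X\subseteq\mathrm{cyc}(Y)$, and (3) for all $Z\in\mathcal{Z}(M)$, either $Z\cap Y$ is independent or $\mathrm{cl}(X\cup\mathrm{cyc}(Z\cap Y))=E$.
   Context: A matroid $M=(E,\rho)$ is given by its rank function. The closure operator is $\mathrm{cl}(X)=\{e\in E:\rho(X\cup e)=\rho(X)\}$ and the cyclic operator is $\mathrm{cyc}(X)=\{e\in X:\rho(X-e)=\rho(X)\}$. $\mathcal{Z}(M)$ is the set of cyclic flats (sets $X$ with $\mathrm{cl}(X)=\mathrm{cyc}(X)=X$). $M|Y/X$ is the matroid on $Y-X$ with rank function $A\mapsto\rho(A\cup X)-\rho(X)$. $U_n^k$ is the uniform matroid on $n$ elements with rank function $A\mapsto\min\{|A|,k\}$. -}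

module Defs where

open import Data.Nat using (ℕ; _≤_; _+_; _∸_; _⊔_; _⊓_)
open import Data.Nat.Properties using (_≟_)
open import Data.Bool using (Bool; true; false; _∧_; if_then_else_)
open import Data.Fin using (Fin)
import Data.Fin.Properties as FinP
open import Data.Fin.Subset using (Subset; _∪_; _∩_; _─_; _-_; _⊆_; ⁅_⁆; ∣_∣; ⊥; ⊤; _∈_)
open import Data.Vec using (lookup; tabulate; foldr′)
open import Data.Product using (Σ; ∃; _×_)
open import Function.Bundles using (_⇔_)
open import Function.Definitions using (Injective)
open import Relation.Binary.PropositionalEquality using (_≡_)
open import Relation.Nullary using (¬_)
open import Relation.Nullary.Decidable using (⌊_⌋)

record Matroid (m : ℕ) : Set where
  field
    ρ          : Subset m → ℕ
    ρ-bounded  : ∀ A → ρ A ≤ ∣ A ∣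
    ρ-mono     : ∀ {A B} → A ⊆ B → ρ A ≤ ρ B
    ρ-submod   : ∀ A B → ρ (A ∪ B) + ρ (A ∩ B) ≤ ρ A + ρ B

module _ {m : ℕ} (M : Matroid m) where
  open Matroid M

  Independent : Subset m → Set
  Independent A = ρ A ≡ ∣ A ∣

  Dependent : Subset m → Set
  Dependent A = ¬ Independent A

  cl : Subset m → Subset m
  cl X = tabulate λ e → ⌊ ρ (X ∪ ⁅ e ⁆) ≟ ρ X ⌋

  cyc : Subset m → Subset m
  cyc X = tabulate λ e → lookup X e ∧ ⌊ ρ (X - e) ≟ ρ X ⌋

  CyclicFlat : Subset m → Set
  CyclicFlat Z = (cl Z ≡ Z) × (cyc Z ≡ Z)

  -- rank function of the minor M|Y/X (on ground set Y - X):
  -- A ↦ ρ(A ∪ X) - ρ(X)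
  minorRank : (X : Subset m) → Subset m → ℕ
  minorRank X A = ρ (A ∪ X) ∸ ρ X

image : ∀ {n m} → (Fin n → Fin m) → Subset n → Subset m
image {n} g A = foldr′ _∪_ ⊥ (tabulate λ i → if lookup A i then ⁅ g i ⁆ else ⊥)

uniformRank : ∀ {n} → ℕ → Subset n → ℕ
uniformRank k A = ∣ A ∣ ⊓ k

MinorIsoUniform : ∀ {m} → Matroid m → (X Y : Subset m) → (n k : ℕ) → Set
MinorIsoUniform M X Y n k =
  Σ (Fin n → Fin _) λ g →
    Injective _≡_ _≡_ g
    × (∀ e → (e ∈ (Y ─ X)) ⇔ (∃ λ i → g i ≡ e))
    × (∀ (A : Subset n) → minorRank M X (image g A) ≡ uniformRank k A)

-- The minor M|Y/X is U_n^k exactly when ρ(A ∪ X) = ρ(X) + min(|A|, k) for every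
-- A ⊆ Y − X.  Conditions (1) and (2) are this rank formula evaluated at a singleton
-- and at (Y − X) − e; the latter still has at least k elements because Y is dependent
-- of full rank while X is independent.  For (3), a circuit C ⊆ Z ∩ Y makes (C − X) ∪ X
-- dependent, so the formula gives it rank ρ(E), and it lies inside X ∪ cyc(Z ∩ Y).
-- Conversely only (3) is needed: if A ⊆ Y − X has |A| ≤ k and A ∪ X contains a circuit C,
-- then cl(C) is a cyclic flat meeting Y in a dependent set, so X ∪ cyc(cl(C) ∩ Y) spans;
-- being contained in cl(A ∪ X) this forces ρ(E) ≤ ρ(A ∪ X) < |A| + |X| ≤ ρ(E).  So A ∪ X
-- is independent whenever |A| ≤ k, which yields the lower bound on ρ(A ∪ X) by adding
-- elements one at a time; the upper bound is subadditivity together with ρ ≤ ρ(E).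

module Submission where

open import Defs
open import Data.Bool using (Bool; true; false; T)
open import Data.Bool.Properties using (T-≡; T-∧)
open import Data.Empty using (⊥-elim)
open import Data.Fin using (Fin; zero; suc)
open import Data.Fin.Properties using (suc-injective; any?)
open import Data.Fin.Subset
open import Data.Fin.Subset.Properties
open import Data.Fin.Subset.Induction using (⊂-wellFounded)
open import Data.Nat using (ℕ; zero; suc; _+_; _∸_; _⊓_; _≤_; _<_)
open import Data.Nat.Properties hiding (suc-injective)
open import Data.Product using (Σ; ∃; _×_; _,_; proj₁; proj₂)
open import Data.Sum using (_⊎_; inj₁; inj₂)
open import Data.Vec using (_∷_; []; lookup; tabulate; here; there)
open import Data.Vec.Properties using (lookup∘tabulate; []=⇒lookup; lookup⇒[]=)
open import Function.Base using (_∘_)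
open import Function.Bundles using (_⇔_; mk⇔; Equivalence)
open import Function.Definitions using (Injective)
open import Function.Properties.Equivalence using () renaming (trans to ⇔-trans)
open import Induction.WellFounded using (WfRec; module All)
open import Relation.Binary.PropositionalEquality
open import Relation.Nullary using (¬_; yes; no; ¬?)
open import Relation.Nullary.Decidable using (toWitness; fromWitness; decidable-stable; _×-dec_)

open Equivalence using (to; from)

Disjoint : ∀ {n} → Subset n → Subset n → Set
Disjoint p q = ∀ {x} → x ∈ p → x ∉ q

∈⇔T-lookup : ∀ {n} {p : Subset n} {x} → x ∈ p ⇔ T (lookup p x)
∈⇔T-lookup {p = p} {x} =
  mk⇔ (λ x∈p → from T-≡ ([]=⇒lookup x∈p)) (λ t → lookup⇒[]= x p (to T-≡ t))

∈-tabulate⇔ : ∀ {n} {f : Fin n → Bool} {x} → x ∈ tabulate f ⇔ T (f x)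
∈-tabulate⇔ {f = f} {x} = subst (λ b → x ∈ tabulate f ⇔ T b) (lookup∘tabulate f x) ∈⇔T-lookup

x∈p─q⇒x∉q : ∀ {n} {p q : Subset n} {x} → x ∈ p ─ q → x ∉ q
x∈p─q⇒x∉q {p = true ∷ p} {false ∷ q} here ()
x∈p─q⇒x∉q {p = _ ∷ p} {_ ∷ q} (there x∈p─q) (there x∈q) = x∈p─q⇒x∉q x∈p─q x∈q

∪-lub : ∀ {n} {p q r : Subset n} → p ⊆ r → q ⊆ r → p ∪ q ⊆ r
∪-lub {p = p} {q} p⊆r q⊆r x∈p∪q with x∈p∪q⁻ p q x∈p∪q
... | inj₁ x∈p = p⊆r x∈p
... | inj₂ x∈q = q⊆r x∈q

∩-glb : ∀ {n} {p q r : Subset n} → r ⊆ p → r ⊆ q → r ⊆ p ∩ q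
∩-glb r⊆p r⊆q x∈r = x∈p∩q⁺ (r⊆p x∈r , r⊆q x∈r)

p⊆q⇒p─r⊆q─r : ∀ {n} {p q : Subset n} r → p ⊆ q → p ─ r ⊆ q ─ r
p⊆q⇒p─r⊆q─r {p = p} r p⊆q x∈p─r = x∈p∧x∉q⇒x∈p─q (p⊆q (p─q⊆p p r x∈p─r)) (x∈p─q⇒x∉q x∈p─r)

⊆p─q⇒Disjoint : ∀ {n} {p q r : Subset n} → r ⊆ p ─ q → Disjoint r q
⊆p─q⇒Disjoint r⊆p─q x∈r = x∈p─q⇒x∉q (r⊆p─q x∈r)

p⊆p─q∪q : ∀ {n} (p q : Subset n) → p ⊆ (p ─ q) ∪ q
p⊆p─q∪q p q {x} x∈p with x ∈? q
... | yes x∈q = q⊆p∪q (p ─ q) q x∈q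
... | no x∉q = p⊆p∪q q (x∈p∧x∉q⇒x∈p─q x∈p x∉q)

x∈p⇒⁅x⁆⊆p : ∀ {n} {p : Subset n} {x} → x ∈ p → ⁅ x ⁆ ⊆ p
x∈p⇒⁅x⁆⊆p {p = p} {x} x∈p y∈⁅x⁆ = subst (_∈ p) (sym (x∈⁅y⁆⇒x≡y x y∈⁅x⁆)) x∈p

x∈p⇒p-x∪⁅x⁆≡p : ∀ {n} {p : Subset n} {x} → x ∈ p → (p - x) ∪ ⁅ x ⁆ ≡ p
x∈p⇒p-x∪⁅x⁆≡p {p = p} {x} x∈p =
  ⊆-antisym (∪-lub (p─q⊆p p ⁅ x ⁆) (x∈p⇒⁅x⁆⊆p x∈p)) (p⊆p─q∪q p ⁅ x ⁆)

∣p∪q∣+∣p∩q∣≡∣p∣+∣q∣ : ∀ {n} (p q : Subset n) → ∣ p ∪ q ∣ + ∣ p ∩ q ∣ ≡ ∣ p ∣ + ∣ q ∣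
∣p∪q∣+∣p∩q∣≡∣p∣+∣q∣ [] [] = refl
∣p∪q∣+∣p∩q∣≡∣p∣+∣q∣ (true ∷ p) (true ∷ q) =
  cong suc (trans (+-suc _ _) (trans (cong suc (∣p∪q∣+∣p∩q∣≡∣p∣+∣q∣ p q)) (sym (+-suc _ _))))
∣p∪q∣+∣p∩q∣≡∣p∣+∣q∣ (true ∷ p) (false ∷ q) = cong suc (∣p∪q∣+∣p∩q∣≡∣p∣+∣q∣ p q)
∣p∪q∣+∣p∩q∣≡∣p∣+∣q∣ (false ∷ p) (true ∷ q) = trans (cong suc (∣p∪q∣+∣p∩q∣≡∣p∣+∣q∣ p q)) (sym (+-suc _ _))
∣p∪q∣+∣p∩q∣≡∣p∣+∣q∣ (false ∷ p) (false ∷ q) = ∣p∪q∣+∣p∩q∣≡∣p∣+∣q∣ p q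

∣p∪q∣≤∣p∣+∣q∣ : ∀ {n} (p q : Subset n) → ∣ p ∪ q ∣ ≤ ∣ p ∣ + ∣ q ∣
∣p∪q∣≤∣p∣+∣q∣ p q = ≤-trans (m≤m+n _ _) (≤-reflexive (∣p∪q∣+∣p∩q∣≡∣p∣+∣q∣ p q))

Disjoint⇒∣p∪q∣≡∣p∣+∣q∣ : ∀ {n} (p q : Subset n) → Disjoint p q → ∣ p ∪ q ∣ ≡ ∣ p ∣ + ∣ q ∣
Disjoint⇒∣p∪q∣≡∣p∣+∣q∣ {n} p q p#q = begin
  ∣ p ∪ q ∣                ≡⟨ sym (+-identityʳ _) ⟩
  ∣ p ∪ q ∣ + 0            ≡⟨ cong (∣ p ∪ q ∣ +_) (sym (∣⊥∣≡0 n)) ⟩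
  ∣ p ∪ q ∣ + ∣ ⊥ {n} ∣    ≡⟨ cong (λ r → ∣ p ∪ q ∣ + ∣ r ∣) (sym p∩q≡⊥) ⟩
  ∣ p ∪ q ∣ + ∣ p ∩ q ∣    ≡⟨ ∣p∪q∣+∣p∩q∣≡∣p∣+∣q∣ p q ⟩
  ∣ p ∣ + ∣ q ∣            ∎
  where
  open ≡-Reasoning
  p∩q≡⊥ : p ∩ q ≡ ⊥
  p∩q≡⊥ = Empty-unique λ (x , x∈p∩q) → p#q (p∩q⊆p p q x∈p∩q) (p∩q⊆q p q x∈p∩q)

∣p∪⁅x⁆∣≤1+∣p∣ : ∀ {n} (p : Subset n) x → ∣ p ∪ ⁅ x ⁆ ∣ ≤ suc ∣ p ∣
∣p∪⁅x⁆∣≤1+∣p∣ p x = begin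
  ∣ p ∪ ⁅ x ⁆ ∣       ≤⟨ ∣p∪q∣≤∣p∣+∣q∣ p ⁅ x ⁆ ⟩
  ∣ p ∣ + ∣ ⁅ x ⁆ ∣   ≡⟨ cong (∣ p ∣ +_) (∣⁅x⁆∣≡1 x) ⟩
  ∣ p ∣ + 1           ≡⟨ +-comm ∣ p ∣ 1 ⟩
  suc ∣ p ∣           ∎
  where open ≤-Reasoning

∣p∣≤1+∣p-x∣ : ∀ {n} (p : Subset n) x → ∣ p ∣ ≤ suc ∣ p - x ∣
∣p∣≤1+∣p-x∣ p x = ≤-trans (p⊆q⇒∣p∣≤∣q∣ (p⊆p─q∪q p ⁅ x ⁆)) (∣p∪⁅x⁆∣≤1+∣p∣ (p - x) x)

∪⁅⁆-induction : ∀ {n} (P : Subset n → Set) → P ⊥ → (∀ p x → P p → P (p ∪ ⁅ x ⁆)) → ∀ p → P p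
∪⁅⁆-induction P P⊥ P∪⁅⁆ = All.wfRec ⊂-wellFounded _ P step
  where
  step : ∀ p → WfRec _⊂_ P p → P p
  step p rec with nonempty? p
  ... | no p-empty = subst P (sym (Empty-unique p-empty)) P⊥
  ... | yes (x , x∈p) = subst P (x∈p⇒p-x∪⁅x⁆≡p x∈p) (P∪⁅⁆ (p - x) x (rec (x∈p⇒p-x⊂p x∈p)))

∈-image⁻ : ∀ {n m} (g : Fin n → Fin m) (A : Subset n) {x} → x ∈ image g A → ∃ λ i → i ∈ A × g i ≡ x
∈-image⁻ g [] x∈ = ⊥-elim (∉⊥ x∈)
∈-image⁻ g (true ∷ A) x∈ with x∈p∪q⁻ ⁅ g zero ⁆ (image (g ∘ suc) A) x∈
... | inj₁ x∈⁅g0⁆ = zero , here , sym (x∈⁅y⁆⇒x≡y _ x∈⁅g0⁆)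
... | inj₂ x∈I = let (i , i∈A , gi≡x) = ∈-image⁻ (g ∘ suc) A x∈I in suc i , there i∈A , gi≡x
∈-image⁻ g (false ∷ A) x∈ with ∈-image⁻ (g ∘ suc) A (subst (_ ∈_) (∪-identityˡ _) x∈)
... | i , i∈A , gi≡x = suc i , there i∈A , gi≡x

∈-image⁺ : ∀ {n m} (g : Fin n → Fin m) (A : Subset n) {i} → i ∈ A → g i ∈ image g A
∈-image⁺ g (true ∷ A) here = p⊆p∪q (image (g ∘ suc) A) (x∈⁅x⁆ (g zero))
∈-image⁺ g (true ∷ A) (there i∈A) = q⊆p∪q ⁅ g zero ⁆ _ (∈-image⁺ (g ∘ suc) A i∈A)
∈-image⁺ g (false ∷ A) (there i∈A) = subst (_ ∈_) (sym (∪-identityˡ _)) (∈-image⁺ (g ∘ suc) A i∈A)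

∣image∣≡∣∣ : ∀ {n m} (g : Fin n → Fin m) → Injective _≡_ _≡_ g → ∀ A → ∣ image g A ∣ ≡ ∣ A ∣
∣image∣≡∣∣ {m = m} g g-inj [] = ∣⊥∣≡0 m
∣image∣≡∣∣ g g-inj (false ∷ A) =
  trans (cong ∣_∣ (∪-identityˡ (image (g ∘ suc) A))) (∣image∣≡∣∣ (g ∘ suc) (suc-injective ∘ g-inj) A)
∣image∣≡∣∣ g g-inj (true ∷ A) = begin
  ∣ ⁅ g zero ⁆ ∪ image (g ∘ suc) A ∣            ≡⟨ Disjoint⇒∣p∪q∣≡∣p∣+∣q∣ _ _ g0∉image ⟩
  ∣ ⁅ g zero ⁆ ∣ + ∣ image (g ∘ suc) A ∣        ≡⟨ cong₂ _+_ (∣⁅x⁆∣≡1 (g zero)) ∣image∣≡∣A∣ ⟩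
  suc ∣ A ∣                                      ∎
  where
  open ≡-Reasoning
  ∣image∣≡∣A∣ : ∣ image (g ∘ suc) A ∣ ≡ ∣ A ∣
  ∣image∣≡∣A∣ = ∣image∣≡∣∣ (g ∘ suc) (suc-injective ∘ g-inj) A
  g0∉image : Disjoint ⁅ g zero ⁆ (image (g ∘ suc) A)
  g0∉image x∈⁅g0⁆ x∈I with ∈-image⁻ (g ∘ suc) A x∈I
  ... | i , _ , gi≡x with g-inj (trans gi≡x (x∈⁅y⁆⇒x≡y _ x∈⁅g0⁆))
  ... | ()

preimage : ∀ {n m} → (Fin n → Fin m) → Subset m → Subset n
preimage g A = tabulate (λ i → lookup A (g i))

image-preimage : ∀ {n m} (g : Fin n → Fin m) {A : Subset m} →
                 (∀ {x} → x ∈ A → ∃ λ i → g i ≡ x) → image g (preimage g A) ≡ A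
image-preimage g {A} A⊆range = ⊆-antisym image⊆A A⊆image
  where
  image⊆A : image g (preimage g A) ⊆ A
  image⊆A x∈ with ∈-image⁻ g (preimage g A) x∈
  ... | i , i∈ , refl = from ∈⇔T-lookup (to ∈-tabulate⇔ i∈)
  A⊆image : A ⊆ image g (preimage g A)
  A⊆image x∈A with A⊆range x∈A
  ... | i , refl = ∈-image⁺ g (preimage g A) (from ∈-tabulate⇔ (to ∈⇔T-lookup x∈A))

Enumerates : ∀ {n m} → Subset m → (Fin n → Fin m) → Set
Enumerates p g = Injective _≡_ _≡_ g × (∀ x → x ∈ p ⇔ ∃ λ i → g i ≡ x)

enumeration : ∀ {m} (p : Subset m) → Σ (Fin ∣ p ∣ → Fin m) (Enumerates p)
enumeration [] = (λ ()) , (λ { {()} }) , (λ ())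
enumeration (false ∷ p) with enumeration p
... | g , g-inj , g-onto = suc ∘ g , g-inj ∘ suc-injective , onto
  where
  onto : ∀ x → x ∈ false ∷ p ⇔ ∃ λ i → suc (g i) ≡ x
  onto zero = mk⇔ (λ ()) (λ ())
  onto (suc x) = mk⇔ (λ { (there x∈p) → let (i , gi≡x) = to (g-onto x) x∈p in i , cong suc gi≡x })
                     (λ (i , gi≡x) → there (from (g-onto x) (i , suc-injective gi≡x)))
enumeration (true ∷ p) with enumeration p
... | g , g-inj , g-onto = g′ , g′-inj , onto
  where
  g′ : Fin (suc ∣ p ∣) → Fin _
  g′ zero = zero
  g′ (suc i) = suc (g i)
  g′-inj : Injective _≡_ _≡_ g′
  g′-inj {zero} {zero} _ = refl
  g′-inj {suc i} {suc j} eq = cong suc (g-inj (suc-injective eq))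
  onto : ∀ x → x ∈ true ∷ p ⇔ ∃ λ i → g′ i ≡ x
  onto zero = mk⇔ (λ _ → zero , refl) (λ _ → here)
  onto (suc x) = mk⇔ (λ { (there x∈p) → let (i , gi≡x) = to (g-onto x) x∈p in suc i , cong suc gi≡x })
                     (λ { (suc i , gi≡x) → there (from (g-onto x) (i , suc-injective gi≡x)) })

module MatroidProperties {m : ℕ} (M : Matroid m) where
  open Matroid M

  ρ-submod-⊆ : ∀ A B {C D} → C ⊆ A ∪ B → D ⊆ A ∩ B → ρ C + ρ D ≤ ρ A + ρ B
  ρ-submod-⊆ A B C⊆A∪B D⊆A∩B = ≤-trans (+-mono-≤ (ρ-mono C⊆A∪B) (ρ-mono D⊆A∩B)) (ρ-submod A B)

  ρ-subadditive : ∀ A B → ρ (A ∪ B) ≤ ρ A + ρ B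
  ρ-subadditive A B = ≤-trans (m≤m+n _ _) (ρ-submod-⊆ A B ⊆-refl ⊥⊆)

  ∈-cl⁻ : ∀ {X e} → e ∈ cl M X → ρ (X ∪ ⁅ e ⁆) ≡ ρ X
  ∈-cl⁻ {X} {e} e∈ = toWitness {a? = ρ (X ∪ ⁅ e ⁆) ≟ ρ X} (to ∈-tabulate⇔ e∈)

  ∈-cl⁺ : ∀ {X e} → ρ (X ∪ ⁅ e ⁆) ≤ ρ X → e ∈ cl M X
  ∈-cl⁺ {X} {e} ρ≤ = from ∈-tabulate⇔ (fromWitness (≤-antisym ρ≤ (ρ-mono (p⊆p∪q ⁅ e ⁆))))

  ∈-cyc⁻ : ∀ {X e} → e ∈ cyc M X → e ∈ X × ρ (X - e) ≡ ρ X
  ∈-cyc⁻ {X} {e} e∈ with to T-∧ (to ∈-tabulate⇔ e∈)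
  ... | e∈X , ρ≡ = from ∈⇔T-lookup e∈X , toWitness {a? = ρ (X - e) ≟ ρ X} ρ≡

  ∈-cyc⁺ : ∀ {X e} → e ∈ X → ρ X ≤ ρ (X - e) → e ∈ cyc M X
  ∈-cyc⁺ {X} {e} e∈X ρ≤ = from ∈-tabulate⇔
    (from T-∧ (to ∈⇔T-lookup e∈X , fromWitness (≤-antisym (ρ-mono (p─q⊆p X ⁅ e ⁆)) ρ≤)))

  cyc⊆ : ∀ X → cyc M X ⊆ X
  cyc⊆ X e∈ = proj₁ (∈-cyc⁻ e∈)

  ⊆cl : ∀ X → X ⊆ cl M X
  ⊆cl X e∈X = ∈-cl⁺ (ρ-mono (∪-lub ⊆-refl (x∈p⇒⁅x⁆⊆p e∈X)))

  ρ-∪⊆cl : ∀ S T → T ⊆ cl M S → ρ (S ∪ T) ≡ ρ S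
  ρ-∪⊆cl S = ∪⁅⁆-induction (λ T → T ⊆ cl M S → ρ (S ∪ T) ≡ ρ S) base step
    where
    base : ⊥ ⊆ cl M S → ρ (S ∪ ⊥) ≡ ρ S
    base _ = cong ρ (∪-identityʳ S)
    step : ∀ T e → (T ⊆ cl M S → ρ (S ∪ T) ≡ ρ S) → T ∪ ⁅ e ⁆ ⊆ cl M S → ρ (S ∪ (T ∪ ⁅ e ⁆)) ≡ ρ S
    step T e ih T∪e⊆cl = ≤-antisym (+-cancelʳ-≤ (ρ S) _ _ (begin
      ρ (S ∪ (T ∪ ⁅ e ⁆)) + ρ S     ≤⟨ ρ-submod-⊆ (S ∪ T) (S ∪ ⁅ e ⁆) split (∩-glb (p⊆p∪q T) (p⊆p∪q ⁅ e ⁆)) ⟩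
      ρ (S ∪ T) + ρ (S ∪ ⁅ e ⁆)     ≡⟨ cong₂ _+_ (ih (T∪e⊆cl ∘ p⊆p∪q ⁅ e ⁆)) (∈-cl⁻ (T∪e⊆cl (q⊆p∪q T ⁅ e ⁆ (x∈⁅x⁆ e)))) ⟩
      ρ S + ρ S                     ∎)) (ρ-mono (p⊆p∪q _))
      where
      open ≤-Reasoning
      split : S ∪ (T ∪ ⁅ e ⁆) ⊆ (S ∪ T) ∪ (S ∪ ⁅ e ⁆)
      split = ∪-lub (p⊆p∪q _ ∘ p⊆p∪q T) (∪-lub (p⊆p∪q _ ∘ q⊆p∪q S T) (q⊆p∪q (S ∪ T) _ ∘ q⊆p∪q S ⁅ e ⁆))

  ρ-cl : ∀ S → ρ (cl M S) ≡ ρ S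
  ρ-cl S = ≤-antisym (≤-trans (ρ-mono (q⊆p∪q S _)) (≤-reflexive (ρ-∪⊆cl S (cl M S) ⊆-refl))) (ρ-mono (⊆cl S))

  cl-mono : ∀ {C S} → C ⊆ S → cl M C ⊆ cl M S
  cl-mono {C} {S} C⊆S {e} e∈clC = ∈-cl⁺ (+-cancelʳ-≤ (ρ C) _ _ (begin
    ρ (S ∪ ⁅ e ⁆) + ρ C          ≤⟨ ρ-submod-⊆ S (C ∪ ⁅ e ⁆) S+e⊆S∪C+e (∩-glb C⊆S (p⊆p∪q _)) ⟩
    ρ S + ρ (C ∪ ⁅ e ⁆)          ≡⟨ cong (ρ S +_) (∈-cl⁻ e∈clC) ⟩
    ρ S + ρ C                    ∎))
    where
    open ≤-Reasoning
    S+e⊆S∪C+e : S ∪ ⁅ e ⁆ ⊆ S ∪ (C ∪ ⁅ e ⁆)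
    S+e⊆S∪C+e = ∪-lub (p⊆p∪q _) (q⊆p∪q S _ ∘ q⊆p∪q C _)

  cl-idem : ∀ S → cl M (cl M S) ≡ cl M S
  cl-idem S = ⊆-antisym cl²⊆cl (⊆cl (cl M S))
    where
    cl²⊆cl : cl M (cl M S) ⊆ cl M S
    cl²⊆cl {e} e∈ = ∈-cl⁺ (begin
      ρ (S ∪ ⁅ e ⁆)          ≤⟨ ρ-mono (∪-lub (p⊆p∪q _ ∘ ⊆cl S) (q⊆p∪q _ _)) ⟩
      ρ (cl M S ∪ ⁅ e ⁆)     ≡⟨ ∈-cl⁻ e∈ ⟩
      ρ (cl M S)             ≡⟨ ρ-cl S ⟩
      ρ S                    ∎)
      where open ≤-Reasoning

  cl≡⊤⇔ρ≡ρ⊤ : ∀ {S} → cl M S ≡ ⊤ ⇔ ρ S ≡ ρ ⊤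
  cl≡⊤⇔ρ≡ρ⊤ {S} = mk⇔ (λ cl≡⊤ → trans (sym (ρ-cl S)) (cong ρ cl≡⊤))
                      (λ ρ≡ → ⊆-antisym ⊆⊤ λ _ → ∈-cl⁺ (≤-trans (ρ-mono ⊆⊤) (≤-reflexive (sym ρ≡))))

  dependent⇒ρ<∣∣ : ∀ {A} → Dependent M A → ρ A < ∣ A ∣
  dependent⇒ρ<∣∣ {A} = ≤∧≢⇒< (ρ-bounded A)

  independent-⊆ : ∀ {A B} → A ⊆ B → Independent M B → Independent M A
  independent-⊆ {A} {B} A⊆B B-ind = ≤-antisym (ρ-bounded A) (+-cancelʳ-≤ ∣ B ─ A ∣ _ _ (begin
    ∣ A ∣ + ∣ B ─ A ∣       ≡⟨ sym (Disjoint⇒∣p∪q∣≡∣p∣+∣q∣ A (B ─ A) (λ x∈A x∈B─A → x∈p─q⇒x∉q x∈B─A x∈A)) ⟩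
    ∣ A ∪ (B ─ A) ∣         ≤⟨ p⊆q⇒∣p∣≤∣q∣ (∪-lub A⊆B (p─q⊆p B A)) ⟩
    ∣ B ∣                   ≡⟨ sym B-ind ⟩
    ρ B                     ≤⟨ ρ-mono (subst (B ⊆_) (∪-comm (B ─ A) A) (p⊆p─q∪q B A)) ⟩
    ρ (A ∪ (B ─ A))         ≤⟨ ρ-subadditive A (B ─ A) ⟩
    ρ A + ρ (B ─ A)         ≤⟨ +-monoʳ-≤ (ρ A) (ρ-bounded (B ─ A)) ⟩
    ρ A + ∣ B ─ A ∣         ∎))
    where open ≤-Reasoning

  Circuit : Subset m → Set
  Circuit C = Dependent M C × (∀ e → e ∈ C → Independent M (C - e))

  ∃-circuit⊆ : ∀ S → Dependent M S → ∃ λ C → C ⊆ S × Circuit C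
  ∃-circuit⊆ = All.wfRec ⊂-wellFounded _ P step
    where
    P : Subset m → Set
    P S = Dependent M S → ∃ λ C → C ⊆ S × Circuit C
    step : ∀ S → WfRec _⊂_ P S → P S
    step S rec S-dep with any? (λ e → (e ∈? S) ×-dec ¬? (ρ (S - e) ≟ ∣ S - e ∣))
    ... | yes (e , e∈S , S-e-dep) =
      let (C , C⊆S-e , C-circ) = rec (x∈p⇒p-x⊂p e∈S) S-e-dep in C , p─q⊆p S _ ∘ C⊆S-e , C-circ
    ... | no ¬smaller =
      S , ⊆-refl , S-dep , λ e e∈S → decidable-stable (ρ (S - e) ≟ ∣ S - e ∣) (λ S-e-dep → ¬smaller (e , e∈S , S-e-dep))

  circuit⊆cyc : ∀ {C} → Circuit C → C ⊆ cyc M C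
  circuit⊆cyc {C} (C-dep , C-e-ind) {e} e∈C = ∈-cyc⁺ e∈C (≤-pred (begin-strict
    ρ C               <⟨ dependent⇒ρ<∣∣ C-dep ⟩
    ∣ C ∣             ≤⟨ ∣p∣≤1+∣p-x∣ C e ⟩
    suc ∣ C - e ∣     ≡⟨ cong suc (sym (C-e-ind e e∈C)) ⟩
    suc (ρ (C - e))   ∎))
    where open ≤-Reasoning

  cyc-mono : ∀ {S W} → S ⊆ W → cyc M S ⊆ cyc M W
  cyc-mono {S} {W} S⊆W {e} e∈cycS with ∈-cyc⁻ e∈cycS
  ... | e∈S , ρS-e≡ρS = ∈-cyc⁺ (S⊆W e∈S) (+-cancelʳ-≤ (ρ S) _ _ (begin
    ρ W + ρ S              ≡⟨ cong (ρ W +_) (sym ρS-e≡ρS) ⟩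
    ρ W + ρ (S - e)        ≤⟨ ρ-submod-⊆ (W - e) S W⊆W-e∪S (∩-glb (p⊆q⇒p─r⊆q─r ⁅ e ⁆ S⊆W) (p─q⊆p S _)) ⟩
    ρ (W - e) + ρ S        ∎))
    where
    open ≤-Reasoning
    W⊆W-e∪S : W ⊆ (W - e) ∪ S
    W⊆W-e∪S = ⊆-trans (p⊆p─q∪q W ⁅ e ⁆) (∪-lub (p⊆p∪q S) (q⊆p∪q (W - e) S ∘ x∈p⇒⁅x⁆⊆p e∈S))

  cl-cyclic : ∀ {S} → S ⊆ cyc M S → cl M S ⊆ cyc M (cl M S)
  cl-cyclic {S} S-cyclic {e} e∈clS with e ∈? S
  ... | yes e∈S = cyc-mono (⊆cl S) (S-cyclic e∈S)
  ... | no e∉S = ∈-cyc⁺ e∈clS (≤-trans (≤-reflexive (ρ-cl S)) (ρ-mono S⊆clS-e))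
    where
    S⊆clS-e : S ⊆ cl M S - e
    S⊆clS-e x∈S = x∈p∧x≢y⇒x∈p-y (⊆cl S x∈S) (λ x≡e → e∉S (subst (_∈ S) x≡e x∈S))

  cl-cyclicFlat : ∀ {S} → S ⊆ cyc M S → CyclicFlat M (cl M S)
  cl-cyclicFlat {S} S-cyclic = cl-idem S , ⊆-antisym (cyc⊆ (cl M S)) (cl-cyclic S-cyclic)

  ∣A∪X∣≡ρX+∣A∣ : ∀ {A X} → Independent M X → Disjoint A X → ∣ A ∪ X ∣ ≡ ρ X + ∣ A ∣
  ∣A∪X∣≡ρX+∣A∣ {A} {X} X-ind A#X =
    trans (Disjoint⇒∣p∪q∣≡∣p∣+∣q∣ A X A#X) (trans (+-comm ∣ A ∣ ∣ X ∣) (cong (_+ ∣ A ∣) (sym X-ind)))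

  ∪-independent⇔ : ∀ {A X} → Independent M X → Disjoint A X →
                   Independent M (A ∪ X) ⇔ ρ (A ∪ X) ≡ ρ X + ∣ A ∣
  ∪-independent⇔ {A} {X} X-ind A#X = mk⇔ (λ ind → trans ind ∣A∪X∣≡) (λ ρ≡ → trans ρ≡ (sym ∣A∪X∣≡))
    where
    ∣A∪X∣≡ : ∣ A ∪ X ∣ ≡ ρ X + ∣ A ∣
    ∣A∪X∣≡ = ∣A∪X∣≡ρX+∣A∣ X-ind A#X

module _ {m : ℕ} (M : Matroid m) where
  open Matroid M
  open MatroidProperties M

  RankFormula : (X D : Subset m) → ℕ → Set
  RankFormula X D k = ∀ A → A ⊆ D → ρ (A ∪ X) ≡ ρ X + ∣ A ∣ ⊓ k

  minorRank≡⇔ : ∀ X A j → minorRank M X A ≡ j ⇔ ρ (A ∪ X) ≡ ρ X + j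
  minorRank≡⇔ X A j = mk⇔
    (λ eq → trans (sym (m+[n∸m]≡n (ρ-mono (q⊆p∪q A X)))) (cong (ρ X +_) eq))
    (λ eq → trans (cong (_∸ ρ X) eq) (m+n∸m≡n (ρ X) j))

  minorIsoUniform⇔rankFormula : ∀ X Y k → MinorIsoUniform M X Y ∣ Y ─ X ∣ k ⇔ RankFormula X (Y ─ X) k
  minorIsoUniform⇔rankFormula X Y k = mk⇔ iso⇒formula formula⇒iso
    where
    iso⇒formula : MinorIsoUniform M X Y ∣ Y ─ X ∣ k → RankFormula X (Y ─ X) k
    iso⇒formula (g , g-inj , g-onto , g-rank) A A⊆D = to (minorRank≡⇔ X A _) (begin
      minorRank M X A              ≡⟨ cong (minorRank M X) (sym image≡A) ⟩
      minorRank M X (image g A′)   ≡⟨ g-rank A′ ⟩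
      ∣ A′ ∣ ⊓ k                   ≡⟨ cong (_⊓ k) (trans (sym (∣image∣≡∣∣ g g-inj A′)) (cong ∣_∣ image≡A)) ⟩
      ∣ A ∣ ⊓ k                    ∎)
      where
      open ≡-Reasoning
      A′ : Subset ∣ Y ─ X ∣
      A′ = preimage g A
      image≡A : image g A′ ≡ A
      image≡A = image-preimage g (λ x∈A → to (g-onto _) (A⊆D x∈A))
    formula⇒iso : RankFormula X (Y ─ X) k → MinorIsoUniform M X Y ∣ Y ─ X ∣ k
    formula⇒iso formula with enumeration (Y ─ X)
    ... | g , g-inj , g-onto = g , g-inj , g-onto , λ A → from (minorRank≡⇔ X (image g A) _)
        (trans (formula (image g A) (image⊆D A)) (cong (λ j → ρ X + j ⊓ k) (∣image∣≡∣∣ g g-inj A)))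
      where
      image⊆D : ∀ A → image g A ⊆ Y ─ X
      image⊆D A x∈ = let (i , _ , gi≡x) = ∈-image⁻ g A x∈ in from (g-onto _) (i , gi≡x)

  ρ[A∪X]≤ρX+∣A∣⊓k : ∀ X k → ρ X + k ≡ ρ ⊤ → ∀ A → ρ (A ∪ X) ≤ ρ X + ∣ A ∣ ⊓ k
  ρ[A∪X]≤ρX+∣A∣⊓k X k ρX+k≡ρ⊤ A = ≤-trans (⊓-glb ρ≤ρX+∣A∣ ρ≤ρX+k) (≤-reflexive (sym (+-distribˡ-⊓ (ρ X) (∣ A ∣) k)))
    where
    ρ≤ρX+∣A∣ : ρ (A ∪ X) ≤ ρ X + ∣ A ∣
    ρ≤ρX+∣A∣ = ≤-trans (ρ-subadditive A X) (≤-trans (+-monoˡ-≤ (ρ X) (ρ-bounded A)) (≤-reflexive (+-comm (∣ A ∣) (ρ X))))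
    ρ≤ρX+k : ρ (A ∪ X) ≤ ρ X + k
    ρ≤ρX+k = ≤-trans (ρ-mono ⊆⊤) (≤-reflexive (sym ρX+k≡ρ⊤))

module Conditions {m : ℕ} (M : Matroid m) (X Y : Subset m) (k : ℕ) where
  open Matroid M
  open MatroidProperties M

  CyclicFlatCondition : Set
  CyclicFlatCondition = ∀ Z → CyclicFlat M Z → Independent M (Z ∩ Y) ⊎ (cl M (X ∪ cyc M (Z ∩ Y)) ≡ ⊤)

  corank<∣Y─X∣ : X ⊆ Y → Independent M X → Dependent M Y → ρ X + k ≡ ρ Y → k < ∣ Y ─ X ∣
  corank<∣Y─X∣ X⊆Y X-ind Y-dep ρX+k≡ρY = +-cancelˡ-< (∣ X ∣) k (∣ Y ─ X ∣) (begin-strict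
    ∣ X ∣ + k                ≡⟨ cong (_+ k) (sym X-ind) ⟩
    ρ X + k                  ≡⟨ ρX+k≡ρY ⟩
    ρ Y                      <⟨ dependent⇒ρ<∣∣ Y-dep ⟩
    ∣ Y ∣                    ≤⟨ p⊆q⇒∣p∣≤∣q∣ (p⊆p─q∪q Y X) ⟩
    ∣ (Y ─ X) ∪ X ∣          ≤⟨ ∣p∪q∣≤∣p∣+∣q∣ (Y ─ X) X ⟩
    ∣ Y ─ X ∣ + ∣ X ∣        ≡⟨ +-comm (∣ Y ─ X ∣) (∣ X ∣) ⟩
    ∣ X ∣ + ∣ Y ─ X ∣        ∎)
    where open ≤-Reasoning

  rankFormula⇒cl∩≡ : X ⊆ Y → 1 ≤ k → RankFormula M X (Y ─ X) k → cl M X ∩ Y ≡ X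
  rankFormula⇒cl∩≡ X⊆Y 1≤k formula = ⊆-antisym cl∩Y⊆X (∩-glb (⊆cl X) X⊆Y)
    where
    cl∩Y⊆X : cl M X ∩ Y ⊆ X
    cl∩Y⊆X {x} x∈ with x ∈? X
    ... | yes x∈X = x∈X
    ... | no x∉X = ⊥-elim (1+n≢n (sym (begin
      ρ X                  ≡⟨ sym (∈-cl⁻ (p∩q⊆p _ _ x∈)) ⟩
      ρ (X ∪ ⁅ x ⁆)        ≡⟨ cong ρ (∪-comm X ⁅ x ⁆) ⟩
      ρ (⁅ x ⁆ ∪ X)        ≡⟨ formula ⁅ x ⁆ (x∈p⇒⁅x⁆⊆p (x∈p∧x∉q⇒x∈p─q (p∩q⊆q _ _ x∈) x∉X)) ⟩
      ρ X + ∣ ⁅ x ⁆ ∣ ⊓ k  ≡⟨ cong (λ j → ρ X + j ⊓ k) (∣⁅x⁆∣≡1 x) ⟩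
      ρ X + 1 ⊓ k          ≡⟨ cong (ρ X +_) (m≤n⇒m⊓n≡m 1≤k) ⟩
      ρ X + 1              ≡⟨ +-comm (ρ X) 1 ⟩
      suc (ρ X)            ∎)))
      where open ≡-Reasoning

  rankFormula⇒⊆cyc : X ⊆ Y → ρ X + k ≡ ρ Y → k < ∣ Y ─ X ∣ → RankFormula M X (Y ─ X) k →
                     Y ─ X ⊆ cyc M Y
  rankFormula⇒⊆cyc X⊆Y ρX+k≡ρY k<∣Y─X∣ formula {e} e∈Y─X = ∈-cyc⁺ (p─q⊆p Y X e∈Y─X) (begin
    ρ Y                            ≡⟨ sym ρX+k≡ρY ⟩
    ρ X + k                        ≡⟨ cong (ρ X +_) (sym (m≥n⇒m⊓n≡n k≤∣Y─X-e∣)) ⟩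
    ρ X + ∣ Y ─ X - e ∣ ⊓ k        ≡⟨ sym (formula (Y ─ X - e) (p─q⊆p (Y ─ X) ⁅ e ⁆)) ⟩
    ρ ((Y ─ X - e) ∪ X)            ≤⟨ ρ-mono (∪-lub (p⊆q⇒p─r⊆q─r ⁅ e ⁆ (p─q⊆p Y X)) X⊆Y-e) ⟩
    ρ (Y - e)                      ∎)
    where
    open ≤-Reasoning
    k≤∣Y─X-e∣ : k ≤ ∣ Y ─ X - e ∣
    k≤∣Y─X-e∣ = ≤-pred (≤-trans k<∣Y─X∣ (∣p∣≤1+∣p-x∣ (Y ─ X) e))
    X⊆Y-e : X ⊆ Y - e
    X⊆Y-e x∈X = x∈p∧x≢y⇒x∈p-y (X⊆Y x∈X) (λ x≡e → x∈p─q⇒x∉q e∈Y─X (subst (_∈ X) x≡e x∈X))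

  rankFormula⇒dependent-∪-spans : Independent M X → ρ X + k ≡ ρ ⊤ → RankFormula M X (Y ─ X) k →
                                   ∀ A → A ⊆ Y ─ X → Dependent M (A ∪ X) → ρ (A ∪ X) ≡ ρ ⊤
  rankFormula⇒dependent-∪-spans X-ind ρX+k≡ρ⊤ formula A A⊆Y─X A∪X-dep with ≤-total ∣ A ∣ k
  ... | inj₁ ∣A∣≤k = ⊥-elim (A∪X-dep (from (∪-independent⇔ X-ind (⊆p─q⇒Disjoint A⊆Y─X))
                      (trans (formula A A⊆Y─X) (cong (ρ X +_) (m≤n⇒m⊓n≡m ∣A∣≤k)))))
  ... | inj₂ k≤∣A∣ = trans (formula A A⊆Y─X) (trans (cong (ρ X +_) (m≥n⇒m⊓n≡n k≤∣A∣)) ρX+k≡ρ⊤)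

  rankFormula⇒independent⊎cyc-spans : Independent M X → ρ X + k ≡ ρ ⊤ → RankFormula M X (Y ─ X) k →
                                      ∀ W → W ⊆ Y → Independent M W ⊎ (cl M (X ∪ cyc M W) ≡ ⊤)
  rankFormula⇒independent⊎cyc-spans X-ind ρX+k≡ρ⊤ formula W W⊆Y with ρ W ≟ ∣ W ∣
  ... | yes W-ind = inj₁ W-ind
  ... | no W-dep with ∃-circuit⊆ W W-dep
  ... | C , C⊆W , C-circ = inj₂ (from cl≡⊤⇔ρ≡ρ⊤ (≤-antisym (ρ-mono ⊆⊤) (begin
    ρ ⊤                   ≡⟨ sym (rankFormula⇒dependent-∪-spans X-ind ρX+k≡ρ⊤ formula (C ─ X) C─X⊆Y─X C─X∪X-dep) ⟩
    ρ ((C ─ X) ∪ X)       ≤⟨ ρ-mono (∪-lub (q⊆p∪q X _ ∘ C⊆cycW ∘ p─q⊆p C X) (p⊆p∪q _)) ⟩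
    ρ (X ∪ cyc M W)       ∎)))
    where
    open ≤-Reasoning
    C─X⊆Y─X : C ─ X ⊆ Y ─ X
    C─X⊆Y─X = p⊆q⇒p─r⊆q─r X (W⊆Y ∘ C⊆W)
    C─X∪X-dep : Dependent M ((C ─ X) ∪ X)
    C─X∪X-dep C─X∪X-ind = proj₁ C-circ (independent-⊆ (p⊆p─q∪q C X) C─X∪X-ind)
    C⊆cycW : C ⊆ cyc M W
    C⊆cycW = cyc-mono C⊆W ∘ circuit⊆cyc C-circ

  cyclicFlatCondition⇒small-independent : X ⊆ Y → Independent M X → ρ X + k ≡ ρ ⊤ → CyclicFlatCondition →
                                          ∀ A → A ⊆ Y ─ X → ∣ A ∣ ≤ k → Independent M (A ∪ X)
  cyclicFlatCondition⇒small-independent X⊆Y X-ind ρX+k≡ρ⊤ condition A A⊆Y─X ∣A∣≤k =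
    decidable-stable (ρ (A ∪ X) ≟ ∣ A ∪ X ∣) ¬dependent
    where
    open ≤-Reasoning
    ¬dependent : ¬ Dependent M (A ∪ X)
    ¬dependent A∪X-dep with ∃-circuit⊆ (A ∪ X) A∪X-dep
    ... | C , C⊆A∪X , C-circ with condition (cl M C) (cl-cyclicFlat (circuit⊆cyc C-circ))
    ... | inj₁ clC∩Y-ind = proj₁ C-circ (independent-⊆ C⊆clC∩Y clC∩Y-ind)
      where
      C⊆clC∩Y : C ⊆ cl M C ∩ Y
      C⊆clC∩Y = ∩-glb (⊆cl C) (∪-lub (p─q⊆p Y X ∘ A⊆Y─X) X⊆Y ∘ C⊆A∪X)
    ... | inj₂ spans = <-irrefl refl (begin-strict
      ρ X + k                        ≡⟨ ρX+k≡ρ⊤ ⟩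
      ρ ⊤                            ≡⟨ sym (to cl≡⊤⇔ρ≡ρ⊤ spans) ⟩
      ρ (X ∪ cyc M (cl M C ∩ Y))     ≤⟨ ρ-mono (∪-lub (⊆cl (A ∪ X) ∘ q⊆p∪q A X) (cl-mono C⊆A∪X ∘ p∩q⊆p _ Y ∘ cyc⊆ _)) ⟩
      ρ (cl M (A ∪ X))               ≡⟨ ρ-cl (A ∪ X) ⟩
      ρ (A ∪ X)                      <⟨ dependent⇒ρ<∣∣ A∪X-dep ⟩
      ∣ A ∪ X ∣                      ≡⟨ ∣A∪X∣≡ρX+∣A∣ X-ind (⊆p─q⇒Disjoint A⊆Y─X) ⟩
      ρ X + ∣ A ∣                    ≤⟨ +-monoʳ-≤ (ρ X) ∣A∣≤k ⟩
      ρ X + k                        ∎)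

  ρX+∣A∣⊓k≤ρ[A∪X] : Independent M X → (∀ A → A ⊆ Y ─ X → ∣ A ∣ ≤ k → Independent M (A ∪ X)) →
                    ∀ A → A ⊆ Y ─ X → ρ X + ∣ A ∣ ⊓ k ≤ ρ (A ∪ X)
  ρX+∣A∣⊓k≤ρ[A∪X] X-ind small-ind = ∪⁅⁆-induction P base step
    where
    open ≤-Reasoning
    P : Subset m → Set
    P A = A ⊆ Y ─ X → ρ X + ∣ A ∣ ⊓ k ≤ ρ (A ∪ X)
    base : P ⊥
    base _ = begin
      ρ X + ∣ ⊥ {m} ∣ ⊓ k    ≡⟨ cong (λ j → ρ X + j ⊓ k) (∣⊥∣≡0 m) ⟩
      ρ X + 0                ≡⟨ +-identityʳ (ρ X) ⟩
      ρ X                    ≡⟨ cong ρ (sym (∪-identityˡ X)) ⟩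
      ρ (⊥ ∪ X)              ∎
    step : ∀ A e → P A → P (A ∪ ⁅ e ⁆)
    step A e ih A+e⊆Y─X with ∣ A ∪ ⁅ e ⁆ ∣ ≤? k
    ... | yes ∣A+e∣≤k = begin
      ρ X + ∣ A ∪ ⁅ e ⁆ ∣ ⊓ k     ≤⟨ +-monoʳ-≤ (ρ X) (m⊓n≤m _ k) ⟩
      ρ X + ∣ A ∪ ⁅ e ⁆ ∣         ≡⟨ sym (to (∪-independent⇔ X-ind A+e#X) (small-ind _ A+e⊆Y─X ∣A+e∣≤k)) ⟩
      ρ ((A ∪ ⁅ e ⁆) ∪ X)         ∎
      where
      A+e#X : Disjoint (A ∪ ⁅ e ⁆) X
      A+e#X = ⊆p─q⇒Disjoint A+e⊆Y─X
    ... | no ∣A+e∣≰k = begin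
      ρ X + ∣ A ∪ ⁅ e ⁆ ∣ ⊓ k     ≡⟨ cong (ρ X +_) (m≥n⇒m⊓n≡n (<⇒≤ (≰⇒> ∣A+e∣≰k))) ⟩
      ρ X + k                     ≡⟨ cong (ρ X +_) (sym (m≥n⇒m⊓n≡n k≤∣A∣)) ⟩
      ρ X + ∣ A ∣ ⊓ k             ≤⟨ ih (A+e⊆Y─X ∘ p⊆p∪q ⁅ e ⁆) ⟩
      ρ (A ∪ X)                   ≤⟨ ρ-mono (∪-lub (p⊆p∪q X ∘ p⊆p∪q ⁅ e ⁆) (q⊆p∪q _ X)) ⟩
      ρ ((A ∪ ⁅ e ⁆) ∪ X)         ∎
      where
      k≤∣A∣ : k ≤ ∣ A ∣
      k≤∣A∣ = ≤-pred (≤-trans (≰⇒> ∣A+e∣≰k) (∣p∪⁅x⁆∣≤1+∣p∣ A e))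

  cyclicFlatCondition⇒rankFormula : X ⊆ Y → Independent M X → ρ X + k ≡ ρ ⊤ → CyclicFlatCondition →
                                    RankFormula M X (Y ─ X) k
  cyclicFlatCondition⇒rankFormula X⊆Y X-ind ρX+k≡ρ⊤ condition A A⊆Y─X = ≤-antisym
    (ρ[A∪X]≤ρX+∣A∣⊓k M X k ρX+k≡ρ⊤ A)
    (ρX+∣A∣⊓k≤ρ[A∪X] X-ind (cyclicFlatCondition⇒small-independent X⊆Y X-ind ρX+k≡ρ⊤ condition) A A⊆Y─X)

theorem4p7 : ∀ {m : ℕ} (M : Matroid m) (X Y : Subset m) →
    X ⊂ Y →
    Dependent M Y →
    Matroid.ρ M Y ≡ Matroid.ρ M ⊤ →
    Independent M X →
    Matroid.ρ M X < Matroid.ρ M ⊤ →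
    MinorIsoUniform M X Y ∣ Y ─ X ∣ (Matroid.ρ M ⊤ ∸ Matroid.ρ M X)
      ⇔ ((cl M X ∩ Y ≡ X)
         × ((Y ─ X) ⊆ cyc M Y)
         × (∀ (Z : Subset m) → CyclicFlat M Z →
              Independent M (Z ∩ Y) ⊎ (cl M (X ∪ cyc M (Z ∩ Y)) ≡ ⊤)))
theorem4p7 M X Y (X⊆Y , _) Y-dep ρY≡ρ⊤ X-ind ρX<ρ⊤ =
  ⇔-trans (minorIsoUniform⇔rankFormula M X Y k) (mk⇔
    (λ formula → rankFormula⇒cl∩≡ X⊆Y (m<n⇒0<n∸m ρX<ρ⊤) formula
               , (λ {e} → rankFormula⇒⊆cyc X⊆Y ρX+k≡ρY (corank<∣Y─X∣ X⊆Y X-ind Y-dep ρX+k≡ρY) formula)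
               , λ Z _ → rankFormula⇒independent⊎cyc-spans X-ind ρX+k≡ρ⊤ formula (Z ∩ Y) (p∩q⊆q Z Y))
    (λ (_ , _ , condition) → cyclicFlatCondition⇒rankFormula X⊆Y X-ind ρX+k≡ρ⊤ condition))
  where
  open Matroid M
  k : ℕ
  k = ρ ⊤ ∸ ρ X
  open Conditions M X Y k
  ρX+k≡ρ⊤ : ρ X + k ≡ ρ ⊤
  ρX+k≡ρ⊤ = m+[n∸m]≡n (<⇒≤ ρX<ρ⊤)
  ρX+k≡ρY : ρ X + k ≡ ρ Y
  ρX+k≡ρY = trans ρX+k≡ρ⊤ (sym ρY≡ρ⊤)
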